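{- Let $F$ be a gerechte framework of order $n$ whose regions are all rectangles and are arranged in columns, i.e. the set of columns $\{1,\dots,n\}$ can be partitioned into intervals of consecutive columns such that the set of columns occupied by each region of $F$ is exactly one of these intervals. Then $F$ is realizable.
   Context: A gerechte framework of order $n$ is a partition of the cells of an $n\times n$ array into $n$ regions, each containing $n$ cells. A region is a rectangle if it consists of all cells lying in some set of consecutive rows and some set of consecutive columns. A latin square of order $n$ is an $n\times n$ array with symbols $1,\dots,n$ in which each symbol appears exactly once in each row and once in each column. A latin square realizes a gerechte framework if, when its cells are partitioned by the framework, each region contains each symbol exactly once; a framework with such a latin square is called realizable. -}

module Defs where

open import Data.Nat using (ℕ)
open import Data.Fin using (Fin; _≤_)
open import Data.Fin.Properties using (_≟_)
open import Data.List using (List; length; filter; allFin; cartesianProduct)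
open import Data.Product using (_×_; _,_; ∃; ∃-syntax; Σ; proj₁; proj₂)
open import Relation.Binary.PropositionalEquality using (_≡_)
open import Relation.Nullary using (Dec)
open import Relation.Nullary.Decidable using (_×-dec_)
open import Function using (_⇔_)

-- Cells of an n×n array: (row , column).
Cell : ℕ → Set
Cell n = Fin n × Fin n

allCells : (n : ℕ) → List (Cell n)
allCells n = cartesianProduct (allFin n) (allFin n)

countCells : {n : ℕ} (P : Cell n → Set) → ((c : Cell n) → Dec (P c)) → ℕ
countCells {n} P P? = length (filter P? (allCells n))

record Framework (n : ℕ) : Set where
  field
    region    : Cell n → Fin n
    regionSize : (r : Fin n) →
      countCells (λ c → region c ≡ r) (λ c → region c ≟ r) ≡ n

open Framework public

InInterval : {n : ℕ} → Fin n → Fin n → Fin n → Set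
InInterval a b x = (a ≤ x) × (x ≤ b)

IsRectangle : {n : ℕ} → Framework n → Fin n → Set
IsRectangle {n} F r =
  ∃[ a ] ∃[ b ] ∃[ c ] ∃[ d ]
    ((i j : Fin n) → (region F (i , j) ≡ r) ⇔ (InInterval a b i × InInterval c d j))

Occupies : {n : ℕ} → Framework n → Fin n → Fin n → Set
Occupies {n} F r j = ∃[ i ] (region F (i , j) ≡ r)

ArrangedInColumns : {n : ℕ} → Framework n → Set
ArrangedInColumns {n} F =
  Σ ℕ λ k → Σ (Fin k → Fin n) λ lo → Σ (Fin k → Fin n) λ hi →
    ((j : Fin n) → ∃[ b ] (InInterval (lo b) (hi b) j ×
        ((b' : Fin k) → InInterval (lo b') (hi b') j → b' ≡ b)))
    × ((r : Fin n) → ∃[ b ] ((j : Fin n) → Occupies F r j ⇔ InInterval (lo b) (hi b) j))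

IsLatin : {n : ℕ} → (Cell n → Fin n) → Set
IsLatin {n} L =
  ((i s : Fin n) → countCells (λ c → (proj₁ c ≡ i) × (L c ≡ s))
                                (λ c → (proj₁ c ≟ i) ×-dec (L c ≟ s)) ≡ 1)
  × ((j s : Fin n) → countCells (λ c → (proj₂ c ≡ j) × (L c ≡ s))
                                (λ c → (proj₂ c ≟ j) ×-dec (L c ≟ s)) ≡ 1)

Realizes : {n : ℕ} → (Cell n → Fin n) → Framework n → Set
Realizes {n} L F =
  (r s : Fin n) → countCells (λ c → (region F c ≡ r) × (L c ≡ s))
                             (λ c → (region F c ≟ r) ×-dec (L c ≟ s)) ≡ 1

Realizable : {n : ℕ} → Framework n → Set
Realizable {n} F = ∃[ L ] (IsLatin L × Realizes L F)

-- Let A i r be the number of cells of region r in row i. Rows and regions all have n cells, so A is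
-- n-regular, and repeated use of Hall's theorem writes it as a sum of n permutation matrices σ s:
-- symbol s is put, in row i, into region σ s i. Inside a block of w columns every region is a
-- full-width stripe, so the 0/1 matrix recording which symbols row i sends into the block is
-- w-regular; writing it as a sum of w permutation matrices, one per column of the block, decides in
-- which column each symbol goes. Every row then receives each symbol once, every column is a
-- permutation, and region r receives symbol s only in the single row i with σ s i ≡ r, where s lands
-- in exactly one column of r's block.

module Submission where

open import Defs
open import Data.Nat using (ℕ; zero; suc; _+_; _*_; _∸_; _≤_; _<_; z≤n; s≤s; _≤?_; _<?_)
open import Data.Nat.Properties hiding (_≟_; suc-injective; 0≢1+n)
open import Data.Nat.Properties as ℕ using ()
open import Algebra.Properties.Semiring.Sum +-*-semiring
  using (sum; sum-syntax; sum-cong-≗; sum-remove; ∑-comm; ∑-distrib-+; *-distribˡ-sum; *-distribʳ-sum)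
open import Data.Fin using (Fin; zero; suc; punchIn)
open import Data.Fin.Properties using (_≟_; 0≢1+n; suc-injective; any?)
open import Data.List using (length; filter; map; tabulate; allFin; cartesianProductWith; _++_)
open import Data.List.Properties using (filter-++; length-++; map-tabulate)
open import Data.Bool using (if_then_else_)
open import Data.Product using (_×_; _,_; ∃; ∃-syntax; proj₁; proj₂)
open import Data.Sum using (inj₁; inj₂)
open import Data.Empty using (⊥-elim)
open import Data.Unit using (tt)
open import Function using (_∘_; Injective)
open import Function.Bundles using (Equivalence)
open Equivalence using (to; from)
open import Relation.Nullary using (Dec; yes; no; ¬_; does; ¬?)
open import Relation.Nullary.Decidable using (_×-dec_; dec-true)
open import Relation.Binary.PropositionalEquality
open import Induction.WellFounded using (Acc; acc)
open import Data.Nat.Induction using (<-wellFounded)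
open import Data.Vec using ([]; _∷_; here; there)
  renaming (tabulate to tabulateᵥ)
open import Data.Vec.Properties using ([]=⇒lookup; lookup⇒[]=; lookup∘tabulate)
import Data.Fin.Subset as Subset
open import Data.Fin.Subset
  using (Subset; inside; outside; _∈_; _∉_; _⊆_; _∪_; _∩_; _─_; _-_; ⁅_⁆; ∣_∣; Nonempty)
open import Data.Fin.Subset.Properties
  using ( _∈?_; _⊆?_; nonempty?; anySubset?; ∈⊤; x∈⁅x⁆; x∈⁅y⁆⇒x≡y; drop-∷-⊆; p∩q⊆p; p─q⊆p
        ; x∈p∩q⁺; x∈p∩q⁻; x∈p∪q⁺; x∈p∪q⁻; x∈p∧x∉q⇒x∈p─q; x∈p∧x≢y⇒x∈p-y
        ; p⊆q⇒∣p∣≤∣q∣; ∣⁅x⁆∣≡1; x∈p⇒∣p-x∣<∣p∣ )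

private variable
  n : ℕ
  P Q : Set

𝟙 : Dec P → ℕ
𝟙 P? = if does P? then 1 else 0

𝟙-yes : (P? : Dec P) → P → 𝟙 P? ≡ 1
𝟙-yes (yes _) _ = refl
𝟙-yes (no ¬p) p = ⊥-elim (¬p p)

𝟙-no : (P? : Dec P) → ¬ P → 𝟙 P? ≡ 0
𝟙-no (yes p) ¬p = ⊥-elim (¬p p)
𝟙-no (no _)  _  = refl

𝟙-pos : (P? : Dec P) → 1 ≤ 𝟙 P? → P
𝟙-pos (yes p) _ = p

𝟙-≤ : ∀ {m} (P? : Dec P) → (P → 1 ≤ m) → 𝟙 P? ≤ m
𝟙-≤ (yes p) 1≤m = 1≤m p
𝟙-≤ (no _)  _   = z≤n

𝟙-cong : (P? : Dec P) (Q? : Dec Q) → (P → Q) → (Q → P) → 𝟙 P? ≡ 𝟙 Q?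
𝟙-cong (yes p) Q? to _    = sym (𝟙-yes Q? (to p))
𝟙-cong (no ¬p) Q? _  from = sym (𝟙-no Q? (¬p ∘ from))

𝟙-× : (P? : Dec P) (Q? : Dec Q) → 𝟙 (P? ×-dec Q?) ≡ 𝟙 P? * 𝟙 Q?
𝟙-× (yes _) (yes _) = refl
𝟙-× (yes _) (no _)  = refl
𝟙-× (no _)  _       = refl

∑-const : ∀ n c → ∑[ i < n ] c ≡ n * c
∑-const zero    c = refl
∑-const (suc n) c = cong (c +_) (∑-const n c)

∑-zero : {f : Fin n → ℕ} → (∀ i → f i ≡ 0) → sum f ≡ 0
∑-zero {n} f≡0 = trans (sum-cong-≗ f≡0) (trans (∑-const n 0) (*-zeroʳ n))

∑-mono-≤ : {f g : Fin n → ℕ} → (∀ i → f i ≤ g i) → sum f ≤ sum g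
∑-mono-≤ {zero}  f≤g = z≤n
∑-mono-≤ {suc n} f≤g = +-mono-≤ (f≤g zero) (∑-mono-≤ (f≤g ∘ suc))

f≤∑f : (f : Fin n → ℕ) (i : Fin n) → f i ≤ sum f
f≤∑f f zero    = m≤m+n _ _
f≤∑f f (suc i) = ≤-trans (f≤∑f (f ∘ suc) i) (m≤n+m _ (f zero))

∑≡0⇒≡0 : (f : Fin n → ℕ) → sum f ≡ 0 → ∀ i → f i ≡ 0
∑≡0⇒≡0 f ∑f≡0 i = n≤0⇒n≡0 (subst (f i ≤_) ∑f≡0 (f≤∑f f i))

∑-pos⇒∃ : (f : Fin n → ℕ) → 1 ≤ sum f → ∃[ i ] 1 ≤ f i
∑-pos⇒∃ {suc n} f 1≤∑f with f zero in eq
... | suc _ = zero , subst (1 ≤_) (sym eq) (s≤s z≤n)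
... | zero  with ∑-pos⇒∃ (f ∘ suc) 1≤∑f
...   | i , 1≤fi = suc i , 1≤fi

∑-select : (h : Fin n → ℕ) (y : Fin n) → ∑[ r < n ] (𝟙 (r ≟ y) * h r) ≡ h y
∑-select {suc n} h zero    = trans (cong₂ _+_ (+-identityʳ (h zero)) (∑-zero {n} λ _ → refl)) (+-identityʳ (h zero))
∑-select {suc n} h (suc y) = ∑-select (h ∘ suc) y

∑-∸ : {f g : Fin n → ℕ} → (∀ i → g i ≤ f i) → sum (λ i → f i ∸ g i) + sum g ≡ sum f
∑-∸ {f = f} {g} g≤f = trans (sym (∑-distrib-+ (λ i → f i ∸ g i) g)) (sum-cong-≗ λ i → m∸n+n≡m (g≤f i))

count : {P : Fin n → Set} → (∀ x → Dec (P x)) → ℕ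
count {n} P? = ∑[ x < n ] 𝟙 (P? x)

count≤1 : {P : Fin n → Set} (P? : ∀ x → Dec (P x)) → (∀ {x y} → P x → P y → x ≡ y) → count P? ≤ 1
count≤1 {zero}  P? unique = z≤n
count≤1 {suc n} P? unique with P? zero
... | yes p₀ = ≤-reflexive (cong suc (∑-zero λ x → 𝟙-no (P? (suc x)) λ px → 0≢1+n (unique p₀ px)))
... | no _   = count≤1 (P? ∘ suc) λ px py → suc-injective (unique px py)

module _ {P : Fin n → Set} (P? : ∀ x → Dec (P x)) where

  ∃⇒1≤count : ∀ {x} → P x → 1 ≤ count P?
  ∃⇒1≤count {x} px = subst (_≤ count P?) (𝟙-yes (P? x) px) (f≤∑f (𝟙 ∘ P?) x)

  1≤count⇒∃ : 1 ≤ count P? → ∃ P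
  1≤count⇒∃ 1≤c with ∑-pos⇒∃ (𝟙 ∘ P?) 1≤c
  ... | x , 1≤𝟙 = x , 𝟙-pos (P? x) 1≤𝟙

  count≡1 : ∀ {x} → P x → (∀ {y} → P y → y ≡ x) → count P? ≡ 1
  count≡1 px unique = ≤-antisym (count≤1 P? (λ py pz → trans (unique py) (sym (unique pz)))) (∃⇒1≤count px)

∑≤1≡n⇒≡1 : (f : Fin n → ℕ) → (∀ i → f i ≤ 1) → sum f ≡ n → ∀ i → f i ≡ 1
∑≤1≡n⇒≡1 {suc n} f f≤1 ∑f≡n i = ≤-antisym (f≤1 i) (+-cancelʳ-≤ n 1 (f i) (begin
  1 + n                     ≡⟨ ∑f≡n ⟨
  sum f                     ≡⟨ sum-remove {i = i} f ⟩
  f i + sum (f ∘ punchIn i) ≤⟨ +-monoʳ-≤ (f i) rest≤n ⟩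
  f i + n                   ∎))
  where
  open ≤-Reasoning
  rest≤n : sum (f ∘ punchIn i) ≤ n
  rest≤n = ≤-trans (∑-mono-≤ (f≤1 ∘ punchIn i)) (≤-reflexive (trans (∑-const n 1) (*-identityʳ n)))

injective⇒count≡1 : (g : Fin n → Fin n) → Injective _≡_ _≡_ g → ∀ s → count (λ i → g i ≟ s) ≡ 1
injective⇒count≡1 {n} g g-inj = ∑≤1≡n⇒≡1 (λ s → count (λ i → g i ≟ s))
  (λ s → count≤1 (λ i → g i ≟ s) λ gx≡s gy≡s → g-inj (trans gx≡s (sym gy≡s)))
  (begin
    ∑[ s < n ] ∑[ i < n ] 𝟙 (g i ≟ s) ≡⟨ ∑-comm (λ s i → 𝟙 (g i ≟ s)) ⟩
    ∑[ i < n ] ∑[ s < n ] 𝟙 (g i ≟ s) ≡⟨ sum-cong-≗ (λ i → count≡1 (g i ≟_) refl sym) ⟩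
    ∑[ i < n ] 1                      ≡⟨ trans (∑-const n 1) (*-identityʳ n) ⟩
    n                                 ∎)
  where open ≡-Reasoning

∑-fibres : ∀ {m} (h : Fin m → ℕ) (g : Fin n → Fin m) →
           ∑[ x < n ] h (g x) ≡ ∑[ r < m ] (count (λ x → g x ≟ r) * h r)
∑-fibres {n} {m} h g = begin
  ∑[ x < n ] h (g x)
    ≡⟨ sum-cong-≗ (λ x → ∑-select h (g x)) ⟨
  ∑[ x < n ] ∑[ r < m ] (𝟙 (r ≟ g x) * h r)
    ≡⟨ sum-cong-≗ (λ x → sum-cong-≗ λ r → cong (_* h r) (𝟙-cong (r ≟ g x) (g x ≟ r) sym sym)) ⟩
  ∑[ x < n ] ∑[ r < m ] (𝟙 (g x ≟ r) * h r)
    ≡⟨ ∑-comm (λ x r → 𝟙 (g x ≟ r) * h r) ⟩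
  ∑[ r < m ] ∑[ x < n ] (𝟙 (g x ≟ r) * h r)
    ≡⟨ sum-cong-≗ (λ r → *-distribʳ-sum (h r) (λ x → 𝟙 (g x ≟ r))) ⟨
  ∑[ r < m ] (count (λ x → g x ≟ r) * h r) ∎
  where open ≡-Reasoning

module _ {A : Set} {P : A → Set} (P? : ∀ x → Dec (P x)) where

  length-filter-tabulate : ∀ {m} (f : Fin m → A) →
                           length (filter P? (tabulate f)) ≡ ∑[ i < m ] 𝟙 (P? (f i))
  length-filter-tabulate {zero}  f = refl
  length-filter-tabulate {suc m} f with P? (f zero)
  ... | yes _ = cong suc (length-filter-tabulate (f ∘ suc))
  ... | no _  = length-filter-tabulate (f ∘ suc)

module _ {P : Cell n → Set} (P? : ∀ c → Dec (P c)) where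

  private
    rows≡∑∑ : ∀ {m} (g : Fin m → Fin n) →
              length (filter P? (cartesianProductWith _,_ (tabulate g) (allFin n)))
              ≡ ∑[ i < m ] ∑[ j < n ] 𝟙 (P? (g i , j))
    rows≡∑∑ {zero}  g = refl
    rows≡∑∑ {suc m} g = begin
      length (filter P? (first ++ rest))                  ≡⟨ cong length (filter-++ P? first rest) ⟩
      length (filter P? first ++ filter P? rest)          ≡⟨ length-++ (filter P? first) ⟩
      length (filter P? first) + length (filter P? rest)  ≡⟨ cong₂ _+_ firstRow (rows≡∑∑ (g ∘ suc)) ⟩
      ∑[ j < n ] 𝟙 (P? (g zero , j)) + ∑[ i < m ] ∑[ j < n ] 𝟙 (P? (g (suc i) , j)) ∎
      where
      open ≡-Reasoning
      first = map (g zero ,_) (allFin n)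
      rest  = cartesianProductWith _,_ (tabulate (g ∘ suc)) (allFin n)
      firstRow : length (filter P? first) ≡ ∑[ j < n ] 𝟙 (P? (g zero , j))
      firstRow = trans (cong (length ∘ filter P?) (map-tabulate (λ j → j) (g zero ,_)))
                       (length-filter-tabulate P? (g zero ,_))

  countCells≡∑∑ : countCells P P? ≡ ∑[ i < n ] ∑[ j < n ] 𝟙 (P? (i , j))
  countCells≡∑∑ = rows≡∑∑ (λ i → i)

module _ {P Q : Cell n → Set} (P? : ∀ c → Dec (P c)) (Q? : ∀ c → Dec (Q c)) where

  countCells-cong : (∀ {c} → P c → Q c) → (∀ {c} → Q c → P c) → countCells P P? ≡ countCells Q Q?
  countCells-cong P⇒Q Q⇒P = trans (countCells≡∑∑ P?) (trans
    (sum-cong-≗ λ i → sum-cong-≗ λ j → 𝟙-cong (P? (i , j)) (Q? (i , j)) P⇒Q Q⇒P)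
    (sym (countCells≡∑∑ Q?)))

module _ {Q : Cell n → Set} (Q? : ∀ c → Dec (Q c)) where

  countCells-row : ∀ i → countCells (λ c → proj₁ c ≡ i × Q c) (λ c → (proj₁ c ≟ i) ×-dec Q? c)
                         ≡ count (λ j → Q? (i , j))
  countCells-row i = begin
    countCells _ (λ c → (proj₁ c ≟ i) ×-dec Q? c)
      ≡⟨ countCells≡∑∑ (λ c → (proj₁ c ≟ i) ×-dec Q? c) ⟩
    ∑[ i′ < n ] ∑[ j < n ] 𝟙 ((i′ ≟ i) ×-dec Q? (i′ , j))
      ≡⟨ sum-cong-≗ (λ i′ → sum-cong-≗ λ j → 𝟙-× (i′ ≟ i) (Q? (i′ , j))) ⟩
    ∑[ i′ < n ] ∑[ j < n ] (𝟙 (i′ ≟ i) * 𝟙 (Q? (i′ , j)))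
      ≡⟨ sum-cong-≗ (λ i′ → *-distribˡ-sum (𝟙 (i′ ≟ i)) (λ j → 𝟙 (Q? (i′ , j)))) ⟨
    ∑[ i′ < n ] (𝟙 (i′ ≟ i) * count (λ j → Q? (i′ , j)))
      ≡⟨ ∑-select (λ i′ → count (λ j → Q? (i′ , j))) i ⟩
    count (λ j → Q? (i , j)) ∎
    where open ≡-Reasoning

  countCells-col : ∀ j → countCells (λ c → proj₂ c ≡ j × Q c) (λ c → (proj₂ c ≟ j) ×-dec Q? c)
                         ≡ count (λ i → Q? (i , j))
  countCells-col j = begin
    countCells _ (λ c → (proj₂ c ≟ j) ×-dec Q? c)
      ≡⟨ countCells≡∑∑ (λ c → (proj₂ c ≟ j) ×-dec Q? c) ⟩
    ∑[ i < n ] ∑[ j′ < n ] 𝟙 ((j′ ≟ j) ×-dec Q? (i , j′))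
      ≡⟨ sum-cong-≗ (λ i → sum-cong-≗ λ j′ → 𝟙-× (j′ ≟ j) (Q? (i , j′))) ⟩
    ∑[ i < n ] ∑[ j′ < n ] (𝟙 (j′ ≟ j) * 𝟙 (Q? (i , j′)))
      ≡⟨ sum-cong-≗ (λ i → ∑-select (λ j′ → 𝟙 (Q? (i , j′))) j) ⟩
    count (λ i → Q? (i , j)) ∎
    where open ≡-Reasoning

∣p∣≡count∈p : (p : Subset n) → ∣ p ∣ ≡ count (_∈? p)
∣p∣≡count∈p []            = refl
∣p∣≡count∈p (inside  ∷ p) = cong suc (∣p∣≡count∈p p)
∣p∣≡count∈p (outside ∷ p) = ∣p∣≡count∈p p

∣p∪q∣+∣p∩q∣≡∣p∣+∣q∣ : (p q : Subset n) → ∣ p ∪ q ∣ + ∣ p ∩ q ∣ ≡ ∣ p ∣ + ∣ q ∣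
∣p∪q∣+∣p∩q∣≡∣p∣+∣q∣ []            []            = refl
∣p∪q∣+∣p∩q∣≡∣p∣+∣q∣ (inside  ∷ p) (inside  ∷ q) =
  cong suc (trans (+-suc _ _) (trans (cong suc (∣p∪q∣+∣p∩q∣≡∣p∣+∣q∣ p q)) (sym (+-suc _ _))))
∣p∪q∣+∣p∩q∣≡∣p∣+∣q∣ (inside  ∷ p) (outside ∷ q) = cong suc (∣p∪q∣+∣p∩q∣≡∣p∣+∣q∣ p q)
∣p∪q∣+∣p∩q∣≡∣p∣+∣q∣ (outside ∷ p) (inside  ∷ q) =
  trans (cong suc (∣p∪q∣+∣p∩q∣≡∣p∣+∣q∣ p q)) (sym (+-suc _ _))
∣p∪q∣+∣p∩q∣≡∣p∣+∣q∣ (outside ∷ p) (outside ∷ q) = ∣p∪q∣+∣p∩q∣≡∣p∣+∣q∣ p q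

∣p∪q∣≤∣p∣+∣q∣ : (p q : Subset n) → ∣ p ∪ q ∣ ≤ ∣ p ∣ + ∣ q ∣
∣p∪q∣≤∣p∣+∣q∣ p q = subst (∣ p ∪ q ∣ ≤_) (∣p∪q∣+∣p∩q∣≡∣p∣+∣q∣ p q) (m≤m+n _ _)

q⊆p⇒∣p∣≡∣q∣+∣p─q∣ : (p q : Subset n) → q ⊆ p → ∣ p ∣ ≡ ∣ q ∣ + ∣ p ─ q ∣
q⊆p⇒∣p∣≡∣q∣+∣p─q∣ []            []            _   = refl
q⊆p⇒∣p∣≡∣q∣+∣p─q∣ (s       ∷ p) (inside  ∷ q) q⊆p with q⊆p here
... | here = cong suc (q⊆p⇒∣p∣≡∣q∣+∣p─q∣ p q (drop-∷-⊆ q⊆p))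
q⊆p⇒∣p∣≡∣q∣+∣p─q∣ (inside  ∷ p) (outside ∷ q) q⊆p =
  trans (cong suc (q⊆p⇒∣p∣≡∣q∣+∣p─q∣ p q (drop-∷-⊆ q⊆p))) (sym (+-suc _ _))
q⊆p⇒∣p∣≡∣q∣+∣p─q∣ (outside ∷ p) (outside ∷ q) q⊆p = q⊆p⇒∣p∣≡∣q∣+∣p─q∣ p q (drop-∷-⊆ q⊆p)

x∈p─q⇒x∉q : ∀ {x} (p q : Subset n) → x ∈ p ─ q → x ∉ q
x∈p─q⇒x∉q (_ ∷ p) (outside ∷ q) here          ()
x∈p─q⇒x∉q (_ ∷ p) (_       ∷ q) (there x∈p─q) (there x∈q) = x∈p─q⇒x∉q p q x∈p─q x∈q

x∈p⇒⁅x⁆⊆p : ∀ {x} {p : Subset n} → x ∈ p → ⁅ x ⁆ ⊆ p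
x∈p⇒⁅x⁆⊆p {x = x} {p} x∈p y∈⁅x⁆ = subst (_∈ p) (sym (x∈⁅y⁆⇒x≡y x y∈⁅x⁆)) x∈p

1≤∣p∣⇒nonempty : (p : Subset n) → 1 ≤ ∣ p ∣ → Nonempty p
1≤∣p∣⇒nonempty p 1≤∣p∣ = 1≤count⇒∃ (_∈? p) (subst (1 ≤_) (∣p∣≡count∈p p) 1≤∣p∣)

disjoint⇒∣p∣+∣q∣≤∣p∪q∣ : (p q : Subset n) → (∀ {x} → x ∈ p → x ∉ q) → ∣ p ∣ + ∣ q ∣ ≤ ∣ p ∪ q ∣
disjoint⇒∣p∣+∣q∣≤∣p∪q∣ p q disjoint = begin
  ∣ p ∣ + ∣ q ∣             ≡⟨ ∣p∪q∣+∣p∩q∣≡∣p∣+∣q∣ p q ⟨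
  ∣ p ∪ q ∣ + ∣ p ∩ q ∣     ≡⟨ cong (∣ p ∪ q ∣ +_) ∣p∩q∣≡0 ⟩
  ∣ p ∪ q ∣ + 0             ≡⟨ +-identityʳ _ ⟩
  ∣ p ∪ q ∣                 ∎
  where
  open ≤-Reasoning
  ∣p∩q∣≡0 : ∣ p ∩ q ∣ ≡ 0
  ∣p∩q∣≡0 = trans (∣p∣≡count∈p (p ∩ q)) (∑-zero λ x → 𝟙-no (x ∈? p ∩ q) λ x∈p∩q →
    let x∈p , x∈q = x∈p∩q⁻ p q x∈p∩q in disjoint x∈p x∈q)

module _ {P : Fin n → Set} (P? : ∀ x → Dec (P x)) where

  subsetOf : Subset n
  subsetOf = tabulateᵥ (does ∘ P?)

  ∈subsetOf⁺ : ∀ {x} → P x → x ∈ subsetOf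
  ∈subsetOf⁺ {x} px = lookup⇒[]= x subsetOf (trans (lookup∘tabulate (does ∘ P?) x) (dec-true (P? x) px))

  ∈subsetOf⁻ : ∀ {x} → x ∈ subsetOf → P x
  ∈subsetOf⁻ {x} x∈ with P? x | trans (sym (lookup∘tabulate (does ∘ P?) x)) ([]=⇒lookup x∈)
  ... | yes px | _ = px

-- Hall's marriage theorem

module Hall {E : Fin n → Fin n → Set} (E? : ∀ i j → Dec (E i j)) where

  private
    adjacent? : (X : Subset n) (j : Fin n) → Dec (∃[ i ] (i ∈ X × E i j))
    adjacent? X j = any? λ i → (i ∈? X) ×-dec E? i j

  neighbours : Subset n → Subset n
  neighbours X = subsetOf (adjacent? X)

  ∈neighbours⁺ : ∀ {X i j} → i ∈ X → E i j → j ∈ neighbours X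
  ∈neighbours⁺ {X} {i} i∈X eij = ∈subsetOf⁺ (adjacent? X) (i , i∈X , eij)

  ∈neighbours⁻ : ∀ {X j} → j ∈ neighbours X → ∃[ i ] (i ∈ X × E i j)
  ∈neighbours⁻ {X} = ∈subsetOf⁻ (adjacent? X)

  HallCondition : Subset n → Subset n → Set
  HallCondition S T = ∀ {X} → X ⊆ S → ∣ X ∣ ≤ ∣ T ∩ neighbours X ∣

  -- match is total; only its values on S matter.
  record Matching (S T : Subset n) : Set where
    field
      match     : Fin n → Fin n
      match∈T   : ∀ {i} → i ∈ S → match i ∈ T
      edge      : ∀ {i} → i ∈ S → E i (match i)
      injective : ∀ {i i′} → i ∈ S → i′ ∈ S → match i ≡ match i′ → i ≡ i′

  open Matching

  matching-∅ : ∀ {S T} → ¬ Nonempty S → Matching S T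
  matching-∅ S≡∅ = record
    { match     = λ i → i
    ; match∈T   = λ i∈S → ⊥-elim (S≡∅ (_ , i∈S))
    ; edge      = λ i∈S → ⊥-elim (S≡∅ (_ , i∈S))
    ; injective = λ i∈S _ _ → ⊥-elim (S≡∅ (_ , i∈S))
    }

  matching-⁅⁆ : ∀ {i y} → E i y → Matching ⁅ i ⁆ ⁅ y ⁆
  matching-⁅⁆ {i} {y} eiy = record
    { match     = λ _ → y
    ; match∈T   = λ _ → x∈⁅x⁆ y
    ; edge      = λ j∈⁅i⁆ → subst (λ j → E j y) (sym (x∈⁅y⁆⇒x≡y i j∈⁅i⁆)) eiy
    ; injective = λ j∈⁅i⁆ j′∈⁅i⁆ _ → trans (x∈⁅y⁆⇒x≡y i j∈⁅i⁆) (sym (x∈⁅y⁆⇒x≡y i j′∈⁅i⁆))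
    }

  matching-neighbours : ∀ {X T} → Matching X T → Matching X (T ∩ neighbours X)
  matching-neighbours M = record
    { match     = match M
    ; match∈T   = λ i∈X → x∈p∩q⁺ (match∈T M i∈X , ∈neighbours⁺ i∈X (edge M i∈X))
    ; edge      = edge M
    ; injective = injective M
    }

  glue : ∀ {S X T T₁} → T₁ ⊆ T → Matching X T₁ → Matching (S ─ X) (T ─ T₁) → Matching S T
  glue {S} {X} {T} {T₁} T₁⊆T M₁ M₂ = record
    { match     = λ i → select (i ∈? X)
    ; match∈T   = λ i∈S → select∈T (_ ∈? X) i∈S
    ; edge      = λ i∈S → select-edge (_ ∈? X) i∈S
    ; injective = λ i∈S i′∈S → select-injective (_ ∈? X) (_ ∈? X) i∈S i′∈S
    }
    where
    outside-X : ∀ {i} → i ∈ S → i ∉ X → i ∈ S ─ X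
    outside-X = x∈p∧x∉q⇒x∈p─q

    select : ∀ {i} → Dec (i ∈ X) → Fin n
    select {i} (yes _) = match M₁ i
    select {i} (no _)  = match M₂ i

    select∈T : ∀ {i} (i∈?X : Dec (i ∈ X)) → i ∈ S → select i∈?X ∈ T
    select∈T (yes i∈X) _   = T₁⊆T (match∈T M₁ i∈X)
    select∈T (no i∉X)  i∈S = p─q⊆p T T₁ (match∈T M₂ (outside-X i∈S i∉X))

    select-edge : ∀ {i} (i∈?X : Dec (i ∈ X)) → i ∈ S → E i (select i∈?X)
    select-edge (yes i∈X) _   = edge M₁ i∈X
    select-edge (no i∉X)  i∈S = edge M₂ (outside-X i∈S i∉X)

    select-injective : ∀ {i i′} (i∈?X : Dec (i ∈ X)) (i′∈?X : Dec (i′ ∈ X)) → i ∈ S → i′ ∈ S →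
                       select i∈?X ≡ select i′∈?X → i ≡ i′
    select-injective (yes i∈X) (yes i′∈X) _   _    = injective M₁ i∈X i′∈X
    select-injective (no i∉X)  (no i′∉X)  i∈S i′∈S =
      injective M₂ (outside-X i∈S i∉X) (outside-X i′∈S i′∉X)
    select-injective (yes i∈X) (no i′∉X)  _   i′∈S eq =
      ⊥-elim (x∈p─q⇒x∉q T T₁ (match∈T M₂ (outside-X i′∈S i′∉X))
                            (subst (_∈ T₁) eq (match∈T M₁ i∈X)))
    select-injective (no i∉X)  (yes i′∈X) i∈S _    eq =
      ⊥-elim (x∈p─q⇒x∉q T T₁ (match∈T M₂ (outside-X i∈S i∉X))
                            (subst (_∈ T₁) (sym eq) (match∈T M₁ i′∈X)))

  Critical : Subset n → Subset n → Subset n → Set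
  Critical S T X = X ⊆ S × 1 ≤ ∣ X ∣ × ∣ X ∣ < ∣ S ∣ × ∣ T ∩ neighbours X ∣ ≤ ∣ X ∣

  critical? : ∀ S T X → Dec (Critical S T X)
  critical? S T X = X ⊆? S ×-dec 1 ≤? ∣ X ∣ ×-dec ∣ X ∣ <? ∣ S ∣ ×-dec ∣ T ∩ neighbours X ∣ ≤? ∣ X ∣

  hall-outsideCritical : ∀ {S T X} → Critical S T X → HallCondition S T →
                         HallCondition (S ─ X) (T ─ (T ∩ neighbours X))
  hall-outsideCritical {S} {T} {X} (X⊆S , _ , _ , ∣NX∣≤∣X∣) hall-S {Y} Y⊆S─X =
    +-cancelʳ-≤ _ _ _ (begin
      ∣ Y ∣ + ∣ X ∣                   ≤⟨ disjoint⇒∣p∣+∣q∣≤∣p∪q∣ Y X Y∩X≡∅ ⟩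
      ∣ Y ∪ X ∣                       ≤⟨ hall-S Y∪X⊆S ⟩
      ∣ T ∩ neighbours (Y ∪ X) ∣      ≤⟨ p⊆q⇒∣p∣≤∣q∣ cover ⟩
      ∣ N′ ∪ NX ∣                     ≤⟨ ∣p∪q∣≤∣p∣+∣q∣ N′ NX ⟩
      ∣ N′ ∣ + ∣ NX ∣                 ≤⟨ +-monoʳ-≤ (∣ N′ ∣) ∣NX∣≤∣X∣ ⟩
      ∣ N′ ∣ + ∣ X ∣                  ∎)
    where
    open ≤-Reasoning
    NX = T ∩ neighbours X
    N′ = (T ─ NX) ∩ neighbours Y

    Y∩X≡∅ : ∀ {i} → i ∈ Y → i ∉ X
    Y∩X≡∅ i∈Y = x∈p─q⇒x∉q S X (Y⊆S─X i∈Y)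

    Y∪X⊆S : Y ∪ X ⊆ S
    Y∪X⊆S i∈Y∪X with x∈p∪q⁻ Y X i∈Y∪X
    ... | inj₁ i∈Y = p─q⊆p S X (Y⊆S─X i∈Y)
    ... | inj₂ i∈X = X⊆S i∈X

    cover : T ∩ neighbours (Y ∪ X) ⊆ N′ ∪ NX
    cover {j} j∈ with j ∈? NX
    ... | yes j∈NX = x∈p∪q⁺ (inj₂ j∈NX)
    ... | no  j∉NX with x∈p∩q⁻ T _ j∈
    ...   | j∈T , j∈N with ∈neighbours⁻ j∈N
    ...     | i , i∈Y∪X , eij with x∈p∪q⁻ Y X i∈Y∪X
    ...       | inj₁ i∈Y = x∈p∪q⁺ (inj₁ (x∈p∩q⁺ (x∈p∧x∉q⇒x∈p─q j∈T j∉NX , ∈neighbours⁺ i∈Y eij)))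
    ...       | inj₂ i∈X = ⊥-elim (j∉NX (x∈p∩q⁺ (j∈T , ∈neighbours⁺ i∈X eij)))

  hall-withoutEdge : ∀ {S T i₀ y} → (∀ X → ¬ Critical S T X) → i₀ ∈ S → HallCondition S T →
                     HallCondition (S - i₀) (T - y)
  hall-withoutEdge {S} {T} {i₀} {y} noCritical i₀∈S hall-S {Y} Y⊆S-i₀ with 1 ≤? ∣ Y ∣
  ... | no  ∣Y∣≱1 = ≤-trans (≮⇒≥ ∣Y∣≱1) z≤n
  ... | yes ∣Y∣≥1 = ≤-pred (begin-strict
      ∣ Y ∣
        <⟨ ≰⇒> (λ ∣NY∣≤∣Y∣ → noCritical Y (Y⊆S , ∣Y∣≥1 , ∣Y∣<∣S∣ , ∣NY∣≤∣Y∣)) ⟩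
      ∣ T ∩ neighbours Y ∣            ≤⟨ p⊆q⇒∣p∣≤∣q∣ cover ⟩
      ∣ N′ ∪ ⁅ y ⁆ ∣                  ≤⟨ ∣p∪q∣≤∣p∣+∣q∣ N′ ⁅ y ⁆ ⟩
      ∣ N′ ∣ + ∣ ⁅ y ⁆ ∣              ≡⟨ cong (∣ N′ ∣ +_) (∣⁅x⁆∣≡1 y) ⟩
      ∣ N′ ∣ + 1                      ≡⟨ +-comm (∣ N′ ∣) 1 ⟩
      suc ∣ N′ ∣                      ∎)
    where
    open ≤-Reasoning
    N′ = (T - y) ∩ neighbours Y

    Y⊆S : Y ⊆ S
    Y⊆S = p─q⊆p S ⁅ i₀ ⁆ ∘ Y⊆S-i₀

    ∣Y∣<∣S∣ : ∣ Y ∣ < ∣ S ∣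
    ∣Y∣<∣S∣ = ≤-<-trans (p⊆q⇒∣p∣≤∣q∣ Y⊆S-i₀) (x∈p⇒∣p-x∣<∣p∣ i₀∈S)

    cover : T ∩ neighbours Y ⊆ N′ ∪ ⁅ y ⁆
    cover {j} j∈ with j ≟ y
    ... | yes refl = x∈p∪q⁺ (inj₂ (x∈⁅x⁆ y))
    ... | no  j≢y  = let j∈T , j∈N = x∈p∩q⁻ T _ j∈ in
                     x∈p∪q⁺ (inj₁ (x∈p∩q⁺ (x∈p∧x≢y⇒x∈p-y j∈T j≢y , j∈N)))

  hall⇒neighbour : ∀ {S T i} → HallCondition S T → i ∈ S → ∃[ y ] (y ∈ T × E i y)
  hall⇒neighbour {S} {T} {i} hall-S i∈S
    with y , y∈T∩N          ← 1≤∣p∣⇒nonempty (T ∩ neighbours ⁅ i ⁆)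
                                (subst (_≤ ∣ T ∩ neighbours ⁅ i ⁆ ∣) (∣⁅x⁆∣≡1 i)
                                       (hall-S (x∈p⇒⁅x⁆⊆p i∈S)))
    with y∈T , y∈N          ← x∈p∩q⁻ T _ y∈T∩N
    with i′ , i′∈⁅i⁆ , ei′y ← ∈neighbours⁻ y∈N
    = y , y∈T , subst (λ k → E k y) (x∈⁅y⁆⇒x≡y i i′∈⁅i⁆) ei′y

  -- Halmos–Vaughan: split S along a critical set if there is one; otherwise match an arbitrary edge,
  -- after which the Hall condition still holds for the rest.
  hall : ∀ S T → HallCondition S T → Matching S T
  hall S = go S (<-wellFounded ∣ S ∣)
    where
    go : ∀ S → Acc _<_ ∣ S ∣ → ∀ T → HallCondition S T → Matching S T
    go S (acc rec) T hall-S with anySubset? (critical? S T)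
    ... | yes (X , critical@(X⊆S , ∣X∣≥1 , ∣X∣<∣S∣ , _)) =
      glue (p∩q⊆p T (neighbours X))
        (matching-neighbours (go X (rec ∣X∣<∣S∣) T (λ Y⊆X → hall-S (X⊆S ∘ Y⊆X))))
        (go (S ─ X) (rec ∣S─X∣<∣S∣) (T ─ (T ∩ neighbours X))
          (hall-outsideCritical {S} {T} critical hall-S))
      where
      ∣S─X∣<∣S∣ : ∣ S ─ X ∣ < ∣ S ∣
      ∣S─X∣<∣S∣ = subst (∣ S ─ X ∣ <_) (sym (q⊆p⇒∣p∣≡∣q∣+∣p─q∣ S X X⊆S)) (m<n+m _ ∣X∣≥1)
    ... | no noCritical with nonempty? S
    ...   | no  S≡∅          = matching-∅ S≡∅
    ...   | yes (i₀ , i₀∈S) with hall⇒neighbour hall-S i₀∈S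
    ...     | y , y∈T , ei₀y =
      glue (x∈p⇒⁅x⁆⊆p y∈T) (matching-⁅⁆ ei₀y)
        (go (S - i₀) (rec (x∈p⇒∣p-x∣<∣p∣ i₀∈S)) (T - y)
          (hall-withoutEdge {S} {T} {y = y} (λ X → noCritical ∘ (X ,_)) i₀∈S hall-S))

-- Regular matrices are sums of permutation matrices

record Regular (d : ℕ) (A : Fin n → Fin n → ℕ) : Set where
  field
    row-sum : ∀ i → ∑[ j < n ] A i j ≡ d
    col-sum : ∀ j → ∑[ i < n ] A i j ≡ d

-- The element of Fin n only witnesses that n is nonzero.
constant-sums-agree : ∀ {a c} (M : Fin n → Fin n → ℕ) → (∀ i → ∑[ s < n ] M i s ≡ a) →
                      (∀ s → ∑[ i < n ] M i s ≡ c) → Fin n → a ≡ c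
constant-sums-agree {suc n} {a} {c} M rows cols _ = *-cancelˡ-≡ a c (suc n) (begin
  suc n * a                          ≡⟨ ∑-const (suc n) a ⟨
  ∑[ i < suc n ] a                   ≡⟨ sum-cong-≗ rows ⟨
  ∑[ i < suc n ] ∑[ s < suc n ] M i s ≡⟨ ∑-comm M ⟩
  ∑[ s < suc n ] ∑[ i < suc n ] M i s ≡⟨ sum-cong-≗ cols ⟩
  ∑[ s < suc n ] c                   ≡⟨ ∑-const (suc n) c ⟩
  suc n * c                          ∎)
  where open ≡-Reasoning

regular⇒perfectMatching : ∀ {d} {A : Fin n → Fin n → ℕ} → Regular (suc d) A →
                          ∃[ σ ] (Injective _≡_ _≡_ σ × ∀ i → 0 < A i (σ i))
regular⇒perfectMatching {n} {d} {A} regular =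
  match , (λ eq → injective ∈⊤ ∈⊤ eq) , (λ i → edge ∈⊤)
  where
  open Regular regular
  open Hall (λ i j → 0 <? A i j)

  scale : ∀ c {f : Fin n → ℕ} → sum f ≡ suc d → suc d * c ≡ ∑[ k < n ] (c * f k)
  scale c {f} ∑f≡1+d = trans (*-comm (suc d) c) (trans (cong (c *_) (sym ∑f≡1+d)) (*-distribˡ-sum c f))

  hall-⊤ : HallCondition Subset.⊤ Subset.⊤
  hall-⊤ {X} _ = *-cancelˡ-≤ (suc d) (begin
    suc d * ∣ X ∣
      ≡⟨ cong (suc d *_) (∣p∣≡count∈p X) ⟩
    suc d * count (_∈? X)
      ≡⟨ *-distribˡ-sum (suc d) (λ i → 𝟙 (i ∈? X)) ⟩
    ∑[ i < n ] (suc d * 𝟙 (i ∈? X))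
      ≡⟨ sum-cong-≗ (λ i → scale (𝟙 (i ∈? X)) (row-sum i)) ⟩
    ∑[ i < n ] ∑[ j < n ] (𝟙 (i ∈? X) * A i j)
      ≡⟨ ∑-comm (λ i j → 𝟙 (i ∈? X) * A i j) ⟩
    ∑[ j < n ] ∑[ i < n ] (𝟙 (i ∈? X) * A i j)
      ≤⟨ ∑-mono-≤ (λ j → ∑-mono-≤ λ i → 𝟙∈X*A≤𝟙∈N*A i j) ⟩
    ∑[ j < n ] ∑[ i < n ] (𝟙 (j ∈? N) * A i j)
      ≡⟨ sum-cong-≗ (λ j → scale (𝟙 (j ∈? N)) (col-sum j)) ⟨
    ∑[ j < n ] (suc d * 𝟙 (j ∈? N))
      ≡⟨ *-distribˡ-sum (suc d) (λ j → 𝟙 (j ∈? N)) ⟨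
    suc d * count (_∈? N)
      ≡⟨ cong (suc d *_) (∣p∣≡count∈p N) ⟨
    suc d * ∣ N ∣
      ≤⟨ *-monoʳ-≤ (suc d) (p⊆q⇒∣p∣≤∣q∣ {p = N} (λ j∈N → x∈p∩q⁺ (∈⊤ , j∈N))) ⟩
    suc d * ∣ Subset.⊤ ∩ N ∣ ∎)
    where
    open ≤-Reasoning
    N = neighbours X

    𝟙∈X*A≤𝟙∈N*A : ∀ i j → 𝟙 (i ∈? X) * A i j ≤ 𝟙 (j ∈? N) * A i j
    𝟙∈X*A≤𝟙∈N*A i j with i ∈? X | A i j in Aij
    ... | no  _   | _     = z≤n
    ... | yes _   | zero  = z≤n
    ... | yes i∈X | suc _ = ≤-reflexive (cong (_* _) (sym (𝟙-yes (j ∈? N) j∈N)))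
      where j∈N = ∈neighbours⁺ i∈X (subst (0 <_) (sym Aij) (s≤s z≤n))

  M = hall Subset.⊤ Subset.⊤ hall-⊤
  open Matching M

permutation-regular : {σ : Fin n → Fin n} → Injective _≡_ _≡_ σ → Regular 1 (λ i j → 𝟙 (σ i ≟ j))
permutation-regular {σ = σ} σ-inj = record
  { row-sum = λ i → count≡1 (σ i ≟_) refl sym
  ; col-sum = injective⇒count≡1 σ σ-inj
  }

regular-∸ : ∀ {d} {A P : Fin n → Fin n → ℕ} → Regular (suc d) A → Regular 1 P →
            (∀ i j → P i j ≤ A i j) → Regular d (λ i j → A i j ∸ P i j)
regular-∸ {n} {d} {A} {P} regA regP P≤A = record
  { row-sum = λ i → cancel (trans (cong (∑[ j < n ] (A i j ∸ P i j) +_) (sym (row-sum regP i)))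
                                  (trans (∑-∸ (P≤A i)) (row-sum regA i)))
  ; col-sum = λ j → cancel (trans (cong (∑[ i < n ] (A i j ∸ P i j) +_) (sym (col-sum regP j)))
                                  (trans (∑-∸ (λ i → P≤A i j)) (col-sum regA j)))
  }
  where
  open Regular
  cancel : ∀ {x} → x + 1 ≡ suc d → x ≡ d
  cancel {x} x+1≡1+d = ℕ.suc-injective (trans (+-comm 1 x) x+1≡1+d)

record Decomposition {m} {C : Fin m → Set} (C? : ∀ c → Dec (C c)) (A : Fin n → Fin n → ℕ) : Set where
  field
    perm           : Fin m → Fin n → Fin n
    perm-injective : ∀ {c} → C c → Injective _≡_ _≡_ (perm c)
    count-perm     : ∀ i j → count (λ c → C? c ×-dec (perm c i ≟ j)) ≡ A i j

_∖?_ : ∀ {m} {C : Fin m → Set} → (∀ c → Dec (C c)) → (c₀ c : Fin m) → Dec (C c × c ≢ c₀)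
(C? ∖? c₀) c = C? c ×-dec ¬? (c ≟ c₀)

module _ {m} {C : Fin m → Set} (C? : ∀ c → Dec (C c)) where

  count-∖ : ∀ {c₀} → C c₀ → count C? ≡ suc (count (C? ∖? c₀))
  count-∖ {c₀} C-c₀ = begin
    count C?
      ≡⟨ sum-cong-≗ split ⟩
    ∑[ c < m ] (𝟙 (c ≟ c₀) + 𝟙 ((C? ∖? c₀) c))
      ≡⟨ ∑-distrib-+ (λ c → 𝟙 (c ≟ c₀)) (λ c → 𝟙 ((C? ∖? c₀) c)) ⟩
    count (_≟ c₀) + count (C? ∖? c₀)
      ≡⟨ cong (_+ count (C? ∖? c₀)) (count≡1 (_≟ c₀) refl (λ eq → eq)) ⟩
    suc (count (C? ∖? c₀)) ∎
    where
    open ≡-Reasoning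
    split : ∀ c → 𝟙 (C? c) ≡ 𝟙 (c ≟ c₀) + 𝟙 ((C? ∖? c₀) c)
    split c = split′ (c ≟ c₀)
      where
      split′ : (c≟c₀ : Dec (c ≡ c₀)) → 𝟙 (C? c) ≡ 𝟙 c≟c₀ + 𝟙 (C? c ×-dec ¬? c≟c₀)
      split′ (yes refl) = trans (𝟙-yes (C? c) C-c₀)
        (cong suc (sym (𝟙-no (C? c ×-dec ¬? (yes (refl {x = c}))) λ (_ , c≢c) → c≢c refl)))
      split′ (no c≢c₀)  = 𝟙-cong (C? c) (C? c ×-dec ¬? (no c≢c₀)) (_, c≢c₀) proj₁

  decomposition-cong : ∀ {A B : Fin n → Fin n → ℕ} → (∀ i j → A i j ≡ B i j) →
                       Decomposition C? A → Decomposition C? B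
  decomposition-cong A≡B D = record
    { perm           = perm
    ; perm-injective = perm-injective
    ; count-perm     = λ i j → trans (count-perm i j) (A≡B i j)
    }
    where open Decomposition D

  decomposition-∅ : ∀ {A : Fin n → Fin n → ℕ} → count C? ≡ 0 → Regular 0 A → Decomposition C? A
  decomposition-∅ {A = A} ∣C∣≡0 regular = record
    { perm           = λ _ i → i
    ; perm-injective = λ _ eq → eq
    ; count-perm     = λ i j → trans
        (∑-zero λ c → trans (𝟙-× (C? c) (i ≟ j))
                            (cong (_* 𝟙 (i ≟ j)) (∑≡0⇒≡0 (𝟙 ∘ C?) ∣C∣≡0 c)))
        (sym (∑≡0⇒≡0 (A i) (Regular.row-sum regular i) j))
    }

  decomposition-extend : ∀ {c₀ A} {σ : Fin n → Fin n} → C c₀ → Injective _≡_ _≡_ σ →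
                         Decomposition (C? ∖? c₀) A → Decomposition C? (λ i j → 𝟙 (σ i ≟ j) + A i j)
  decomposition-extend {n} {c₀} {A} {σ} C-c₀ σ-inj D = record
    { perm           = λ c → extend (c ≟ c₀)
    ; perm-injective = λ {c} → extend-injective (c ≟ c₀)
    ; count-perm     = λ i j → begin
        count (λ c → C? c ×-dec (extend (c ≟ c₀) i ≟ j))
          ≡⟨ sum-cong-≗ (λ c → 𝟙-extend i j c (c ≟ c₀)) ⟩
        ∑[ c < m ] (𝟙 (c ≟ c₀) * 𝟙 (σ i ≟ j) + 𝟙 ((C? ∖? c₀) c ×-dec (perm c i ≟ j)))
          ≡⟨ ∑-distrib-+ (λ c → 𝟙 (c ≟ c₀) * 𝟙 (σ i ≟ j))
                         (λ c → 𝟙 ((C? ∖? c₀) c ×-dec (perm c i ≟ j))) ⟩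
        ∑[ c < m ] (𝟙 (c ≟ c₀) * 𝟙 (σ i ≟ j)) + count (λ c → (C? ∖? c₀) c ×-dec (perm c i ≟ j))
          ≡⟨ cong₂ _+_ (∑-select (λ _ → 𝟙 (σ i ≟ j)) c₀) (count-perm i j) ⟩
        𝟙 (σ i ≟ j) + A i j
          ∎
    }
    where
    open ≡-Reasoning
    open Decomposition D

    extend : ∀ {c} → Dec (c ≡ c₀) → Fin n → Fin n
    extend     (yes _) = σ
    extend {c} (no _)  = perm c

    extend-injective : ∀ {c} (c≟c₀ : Dec (c ≡ c₀)) → C c → Injective _≡_ _≡_ (extend c≟c₀)
    extend-injective (yes _)   _   = σ-inj
    extend-injective (no c≢c₀) C-c = perm-injective (C-c , c≢c₀)

    𝟙-extend : ∀ i j c (c≟c₀ : Dec (c ≡ c₀)) →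
               𝟙 (C? c ×-dec (extend c≟c₀ i ≟ j))
               ≡ 𝟙 c≟c₀ * 𝟙 (σ i ≟ j) + 𝟙 ((C? c ×-dec ¬? c≟c₀) ×-dec (perm c i ≟ j))
    𝟙-extend i j c (yes refl) = begin
      𝟙 (C? c ×-dec (σ i ≟ j))      ≡⟨ 𝟙-× (C? c) (σ i ≟ j) ⟩
      𝟙 (C? c) * 𝟙 (σ i ≟ j)       ≡⟨ cong (_* 𝟙 (σ i ≟ j)) (𝟙-yes (C? c) C-c₀) ⟩
      1 * 𝟙 (σ i ≟ j)              ≡⟨ +-identityʳ _ ⟨
      1 * 𝟙 (σ i ≟ j) + 0
        ≡⟨ cong (1 * 𝟙 (σ i ≟ j) +_) (𝟙-no c₀-removed λ ((_ , c≢c) , _) → c≢c refl) ⟨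
      1 * 𝟙 (σ i ≟ j) + 𝟙 c₀-removed ∎
      where c₀-removed = (C? c ×-dec ¬? (yes (refl {x = c}))) ×-dec (perm c i ≟ j)
    𝟙-extend i j c (no c≢c₀) =
      𝟙-cong (C? c ×-dec (perm c i ≟ j)) ((C? c ×-dec ¬? (no c≢c₀)) ×-dec (perm c i ≟ j))
             (λ (C-c , eq) → (C-c , c≢c₀) , eq) (λ ((C-c , _) , eq) → C-c , eq)

regular⇒decomposition : ∀ {m} d {C : Fin m → Set} (C? : ∀ c → Dec (C c)) {A : Fin n → Fin n → ℕ} →
                        count C? ≡ d → Regular d A → Decomposition C? A
regular⇒decomposition zero    C? ∣C∣≡0   regular = decomposition-∅ C? ∣C∣≡0 regular
regular⇒decomposition (suc d) C? {A} ∣C∣≡1+d regular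
  with σ , σ-inj , σ⊆A ← regular⇒perfectMatching regular
     | c₀ , C-c₀       ← 1≤count⇒∃ C? (subst (1 ≤_) (sym ∣C∣≡1+d) (s≤s z≤n))
  = decomposition-cong C? (λ i j → m+[n∸m]≡n (P≤A i j))
      (decomposition-extend C? C-c₀ σ-inj
        (regular⇒decomposition d (C? ∖? c₀) ∣C∖c₀∣≡d
          (regular-∸ regular (permutation-regular σ-inj) P≤A)))
  where
  P≤A : ∀ i j → 𝟙 (σ i ≟ j) ≤ A i j
  P≤A i j = 𝟙-≤ (σ i ≟ j) λ { refl → σ⊆A i }
  ∣C∖c₀∣≡d : count (C? ∖? c₀) ≡ d
  ∣C∖c₀∣≡d = ℕ.suc-injective (trans (sym (count-∖ C? C-c₀)) ∣C∣≡1+d)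

-- Frameworks arranged in columns

record ColumnBlocks (F : Framework n) : Set where
  field
    blocks       : ℕ
    block        : Fin n → Fin blocks
    regionBlock  : Fin n → Fin blocks
    block-region : ∀ {i j r} → region F (i , j) ≡ r → block j ≡ regionBlock r
    fill-row     : ∀ {i j j′ r} → region F (i , j′) ≡ r → block j ≡ regionBlock r → region F (i , j) ≡ r

columnBlocks : (F : Framework n) → (∀ r → IsRectangle F r) → ArrangedInColumns F → ColumnBlocks F
columnBlocks {n} F rectangle (k , lo , hi , columnBlock , regionColumns) = record
  { blocks       = k
  ; block        = block
  ; regionBlock  = regionBlock
  ; block-region = λ {i} {j} {r} e → sym (proj₂ (proj₂ (columnBlock j)) (regionBlock r)
                                      (to (proj₂ (regionColumns r) j) (i , e)))
  ; fill-row     = fill-row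
  }
  where
  block : Fin n → Fin k
  block j = proj₁ (columnBlock j)

  regionBlock : Fin n → Fin k
  regionBlock r = proj₁ (regionColumns r)

  -- (i , j) shares its row with the cell (i , j′) of r and its column with some cell (i′ , j) of r,
  -- which exists because j lies in the column interval of r; so it lies in the rectangle r.
  fill-row : ∀ {i j j′ r} → region F (i , j′) ≡ r → block j ≡ regionBlock r → region F (i , j) ≡ r
  fill-row {i} {j} {j′} {r} e j∈r
    with _ , _ , _ , _ , rect ← rectangle r
    with i′ , e′ ← from (proj₂ (regionColumns r) j)
                        (subst (λ b → InInterval (lo b) (hi b) j) j∈r (proj₁ (proj₂ (columnBlock j))))
    = from (rect i j) (proj₁ (to (rect i j′) e) , proj₂ (to (rect i′ j) e′))

module Realization (F : Framework n) (B : ColumnBlocks F) where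

  open ColumnBlocks B

  rowRegionCount : Fin n → Fin n → ℕ
  rowRegionCount i r = count (λ j → region F (i , j) ≟ r)

  rowRegionCount-regular : Regular n rowRegionCount
  rowRegionCount-regular = record
    { row-sum = λ i → begin
        ∑[ r < n ] ∑[ j < n ] 𝟙 (region F (i , j) ≟ r)
          ≡⟨ ∑-comm (λ r j → 𝟙 (region F (i , j) ≟ r)) ⟩
        ∑[ j < n ] ∑[ r < n ] 𝟙 (region F (i , j) ≟ r)
          ≡⟨ sum-cong-≗ (λ j → count≡1 (region F (i , j) ≟_) refl sym) ⟩
        ∑[ j < n ] 1
          ≡⟨ trans (∑-const n 1) (*-identityʳ n) ⟩
        n ∎
    ; col-sum = λ r → trans (sym (countCells≡∑∑ (λ c → region F c ≟ r))) (regionSize F r)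
    }
    where open ≡-Reasoning

  symbolRegion : Decomposition {m = n} (λ _ → yes tt) rowRegionCount
  symbolRegion = regular⇒decomposition n (λ _ → yes tt) (trans (∑-const n 1) (*-identityʳ n))
                                       rowRegionCount-regular

  -- σ s i is the region that receives symbol s in row i.
  σ : Fin n → Fin n → Fin n
  σ = Decomposition.perm symbolRegion

  σ-injective : ∀ s → Injective _≡_ _≡_ (σ s)
  σ-injective s = Decomposition.perm-injective symbolRegion tt

  σ-count : ∀ i r → count (λ s → σ s i ≟ r) ≡ rowRegionCount i r
  σ-count = Decomposition.count-perm symbolRegion

  σ-meets-row : ∀ s i → ∃[ j ] region F (i , j) ≡ σ s i
  σ-meets-row s i = 1≤count⇒∃ (λ j → region F (i , j) ≟ σ s i)
    (subst (1 ≤_) (σ-count i (σ s i)) (∃⇒1≤count (λ s′ → σ s′ i ≟ σ s i) refl))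

  region≡σ : ∀ {s i j} → block j ≡ regionBlock (σ s i) → region F (i , j) ≡ σ s i
  region≡σ {s} {i} = fill-row (proj₂ (σ-meets-row s i))

  width : Fin blocks → ℕ
  width b = count (λ j → block j ≟ b)

  inBlock : Fin blocks → Fin n → Fin n → ℕ
  inBlock b i s = 𝟙 (regionBlock (σ s i) ≟ b)

  inBlock-row-sum : ∀ b i → ∑[ s < n ] inBlock b i s ≡ width b
  inBlock-row-sum b i = begin
    ∑[ s < n ] h (σ s i)
      ≡⟨ ∑-fibres h (λ s → σ s i) ⟩
    ∑[ r < n ] (count (λ s → σ s i ≟ r) * h r)
      ≡⟨ sum-cong-≗ (λ r → cong (_* h r) (σ-count i r)) ⟩
    ∑[ r < n ] (rowRegionCount i r * h r)
      ≡⟨ ∑-fibres h (λ j → region F (i , j)) ⟨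
    ∑[ j < n ] h (region F (i , j))
      ≡⟨ sum-cong-≗ (λ j → 𝟙-cong (_ ≟ b) (block j ≟ b)
                             (trans (block-region refl)) (trans (sym (block-region refl)))) ⟩
    width b ∎
    where
    open ≡-Reasoning
    h = λ r → 𝟙 (regionBlock r ≟ b)

  inBlock-col-sum : ∀ b s → ∑[ i < n ] inBlock b i s ≡ count (λ r → regionBlock r ≟ b)
  inBlock-col-sum b s = begin
    ∑[ i < n ] h (σ s i)
      ≡⟨ ∑-fibres h (σ s) ⟩
    ∑[ r < n ] (count (λ i → σ s i ≟ r) * h r)
      ≡⟨ sum-cong-≗ (λ r → cong (_* h r) (injective⇒count≡1 (σ s) (σ-injective s) r)) ⟩
    ∑[ r < n ] (1 * h r)
      ≡⟨ sum-cong-≗ (λ r → *-identityˡ (h r)) ⟩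
    count (λ r → regionBlock r ≟ b) ∎
    where
    open ≡-Reasoning
    h = λ r → 𝟙 (regionBlock r ≟ b)

  inBlock-regular : ∀ b → Regular (width b) (inBlock b)
  inBlock-regular b = record
    { row-sum = inBlock-row-sum b
    ; col-sum = λ s → trans (inBlock-col-sum b s)
        (sym (constant-sums-agree (inBlock b) (inBlock-row-sum b) (inBlock-col-sum b) s))
    }

  columnSymbol : ∀ b → Decomposition (λ j → block j ≟ b) (inBlock b)
  columnSymbol b = regular⇒decomposition (width b) (λ j → block j ≟ b) refl (inBlock-regular b)

  -- For a column j of block b, τ b j i is the symbol placed in cell (i , j).
  τ : Fin blocks → Fin n → Fin n → Fin n
  τ b = Decomposition.perm (columnSymbol b)

  τ-count : ∀ b i s → count (λ j → (block j ≟ b) ×-dec (τ b j i ≟ s)) ≡ inBlock b i s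
  τ-count b = Decomposition.count-perm (columnSymbol b)

  L : Cell n → Fin n
  L (i , j) = τ (block j) j i

  L-block : ∀ {i j s} → L (i , j) ≡ s → block j ≡ regionBlock (σ s i)
  L-block {i} {j} {s} Lij≡s = sym (𝟙-pos (regionBlock (σ s i) ≟ block j)
    (subst (1 ≤_) (τ-count (block j) i s)
      (∃⇒1≤count (λ j′ → (block j′ ≟ block j) ×-dec (τ (block j) j′ i ≟ s)) (refl , Lij≡s))))

  L-rows : ∀ i s → countCells (λ c → proj₁ c ≡ i × L c ≡ s) (λ c → (proj₁ c ≟ i) ×-dec (L c ≟ s)) ≡ 1
  L-rows i s = begin
    countCells _ (λ c → (proj₁ c ≟ i) ×-dec (L c ≟ s))
      ≡⟨ countCells-row (λ c → L c ≟ s) i ⟩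
    count (λ j → L (i , j) ≟ s)
      ≡⟨ sum-cong-≗ (λ j → 𝟙-cong (L (i , j) ≟ s) (inb₀? j) to-b₀ from-b₀) ⟩
    count inb₀?
      ≡⟨ τ-count b₀ i s ⟩
    𝟙 (b₀ ≟ b₀)
      ≡⟨ 𝟙-yes (b₀ ≟ b₀) refl ⟩
    1 ∎
    where
    open ≡-Reasoning
    b₀ = regionBlock (σ s i)
    inb₀? = λ j → (block j ≟ b₀) ×-dec (τ b₀ j i ≟ s)
    to-b₀ : ∀ {j} → L (i , j) ≡ s → block j ≡ b₀ × τ b₀ j i ≡ s
    to-b₀ Lij≡s = L-block Lij≡s , subst (λ b → τ b _ i ≡ s) (L-block Lij≡s) Lij≡s
    from-b₀ : ∀ {j} → block j ≡ b₀ × τ b₀ j i ≡ s → L (i , j) ≡ s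
    from-b₀ {j} (j∈b₀ , τ≡s) = subst (λ b → τ b j i ≡ s) (sym j∈b₀) τ≡s

  L-cols : ∀ j s → countCells (λ c → proj₂ c ≡ j × L c ≡ s) (λ c → (proj₂ c ≟ j) ×-dec (L c ≟ s)) ≡ 1
  L-cols j s = trans (countCells-col (λ c → L c ≟ s) j)
    (injective⇒count≡1 (τ (block j) j) (Decomposition.perm-injective (columnSymbol (block j)) refl) s)

  L-realizes : Realizes L F
  L-realizes r s with i₀ , σsi₀≡r ← 1≤count⇒∃ (λ i → σ s i ≟ r)
                                      (≤-reflexive (sym (injective⇒count≡1 (σ s) (σ-injective s) r)))
    = begin
      countCells _ (λ c → (region F c ≟ r) ×-dec (L c ≟ s))
        ≡⟨ countCells-cong _ (λ c → (proj₁ c ≟ i₀) ×-dec inRow? c) toRow fromRow ⟩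
      countCells _ (λ c → (proj₁ c ≟ i₀) ×-dec inRow? c)
        ≡⟨ countCells-row inRow? i₀ ⟩
      count (λ j → (block j ≟ b) ×-dec (τ b j i₀ ≟ s))
        ≡⟨ τ-count b i₀ s ⟩
      𝟙 (regionBlock (σ s i₀) ≟ b)
        ≡⟨ 𝟙-yes (regionBlock (σ s i₀) ≟ b) (cong regionBlock σsi₀≡r) ⟩
      1 ∎
    where
    open ≡-Reasoning
    b = regionBlock r

    inRow? : ∀ c → Dec (block (proj₂ c) ≡ b × τ b (proj₂ c) (proj₁ c) ≡ s)
    inRow? (i , j) = (block j ≟ b) ×-dec (τ b j i ≟ s)

    toRow : ∀ {c} → region F c ≡ r × L c ≡ s →
            proj₁ c ≡ i₀ × block (proj₂ c) ≡ b × τ b (proj₂ c) (proj₁ c) ≡ s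
    toRow {i , j} (region≡r , Lij≡s) =
      σ-injective s (trans (sym (region≡σ (L-block Lij≡s))) (trans region≡r (sym σsi₀≡r))) ,
      block-region region≡r ,
      subst (λ b′ → τ b′ j i ≡ s) (block-region region≡r) Lij≡s

    fromRow : ∀ {c} → proj₁ c ≡ i₀ × block (proj₂ c) ≡ b × τ b (proj₂ c) (proj₁ c) ≡ s →
              region F c ≡ r × L c ≡ s
    fromRow {i , j} (refl , j∈b , τ≡s) =
      trans (region≡σ (trans j∈b (cong regionBlock (sym σsi₀≡r)))) σsi₀≡r ,
      subst (λ b′ → τ b′ j i ≡ s) (sym j∈b) τ≡s

theorem9 : (n : ℕ) (F : Framework n) →
    ((r : Fin n) → IsRectangle F r) →
    ArrangedInColumns F →
    Realizable F
theorem9 n F rectangles arranged = L , (L-rows , L-cols) , L-realizes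
  where open Realization F (columnBlocks F rectangles arranged)
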